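{- For binary strings $s,t\in\{0,1\}^n$, let $\mathrm{LCS}(s,t)$ denote the length of a longest common subsequence of $s$ and $t$. Let $s$ and $t$ be drawn independently and uniformly at random from $\{0,1\}^n$. Then \[ \mathbb{E}\big[\mathrm{LCS}(s,t)\big] \le 0.867\,n + o(n) \] as $n\to\infty$.
   Context: A string $u=u_1\cdots u_m$ is a subsequence of $t=t_1\cdots t_n$ if there are indices $i_1<\dots<i_m$ with $u_j=t_{i_j}$ for all $j$. A longest common subsequence of $s$ and $t$ is a longest string that is a subsequence of both. -}

module Defs where

open import Data.Bool using (Bool; true; false)
open import Data.Bool.Properties using () renaming (_≟_ to _≟B_)
open import Data.Nat using (ℕ; zero; suc; _+_; _*_; _^_; _⊔_)
open import Data.List using (List; []; _∷_; map; concatMap; filter; foldr; length; upTo)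
open import Data.Nat.ListAction using (sum)
open import Data.Product using (_×_)
open import Relation.Nullary using (_×-dec_)
open import Data.List.Relation.Binary.Sublist.DecPropositional _≟B_ public
  using (_⊆_; _⊆?_)

-- Binary strings are lists of Bool.  u ⊆ s (stdlib Sublist) is exactly
-- "u is a subsequence of s" (order-preserving embedding).

strings : ℕ → List (List Bool)
strings zero    = [] ∷ []
strings (suc n) = concatMap (λ w → (false ∷ w) ∷ (true ∷ w) ∷ []) (strings n)

IsCommonSubseq : List Bool → List Bool → List Bool → Set
IsCommonSubseq u s t = (u ⊆ s) × (u ⊆ t)

-- LCS(s,t): the maximum length of a common subsequence.  Every common
-- subsequence u of s has length ≤ length s, so we maximise over all binary
-- strings of length 0..length s.
LCS : List Bool → List Bool → ℕ
LCS s t = foldr _⊔_ 0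
  (map length
    (filter (λ u → (u ⊆? s) ×-dec (u ⊆? t))
      (concatMap strings (upTo (suc (length s))))))

-- Sum of LCS(s,t) over all (s,t) ∈ {0,1}^n × {0,1}^n.
-- E[LCS(s,t)] for uniform independent s,t equals totalLCS n / 4^n.
totalLCS : ℕ → ℕ
totalLCS n = sum (concatMap (λ s → map (λ t → LCS s t) (strings n)) (strings n))

{-# OPTIONS --safe #-}

-- First moment method.  If LCS(s,t) > L then s and t share a common subsequence
-- of length exactly L, so LCS(s,t) ≤ L + n·#{common subsequences of length L}.
-- Summed over all s, t ∈ {0,1}ⁿ the second term counts triples (u,s,t), that is
-- Σ_{|u|=L} N(u)², where N(u) is the number of strings of length n containing u.
-- Unfolding N_{n+1}(x∷u) ≤ N_n(u) + N_n(x∷u) with weights gives the Chernoff-type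
-- bound aⁿ b^|u| N(u) ≤ a^|u| (a+b)ⁿ for a ≤ b.  Take L ≈ 13n/15 and the optimal
-- tilt b/a = 13/2: each block of 15 letters of s, 13 of them matched by u, then
-- contributes a factor E/D ≈ 0.9967 < 1 to the bound on 4⁻ⁿ Σ_u N(u)², so that
-- term is o(1/n) and E[LCS] ≤ 13n/15 + o(n).

module Submission where

open import Defs
open import Data.Bool using (Bool; true; false)
open import Data.List using (List; []; _∷_; map; concatMap; filter; length; take; upTo)
open import Data.List.Properties using (length-take)
open import Data.List.Membership.Propositional.Properties using (∈-map⁻; ∈-filter⁻; foldr-selective)
open import Data.List.Relation.Binary.Sublist.Heterogeneous using (minimum)
open import Data.List.Relation.Binary.Sublist.Heterogeneous.Properties
  using (∷⁻; ∷ʳ⁻; length-mono-≤; take-Sublist)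
open import Data.Nat using (ℕ; zero; suc; _+_; _*_; _^_; _≤_; _<_; _≤?_; z≤n; NonZero; >-nonZero)
open import Data.Nat.Properties
open import Data.Nat.DivMod using (_/_; _%_; m≡m%n+[m/n]*n; m%n<n; m*n/n≡m; /-monoˡ-≤)
open import Data.Nat.ListAction using (sum)
open import Data.Nat.ListAction.Properties using (sum-++)
open import Data.Nat.Tactic.RingSolver using (solve-∀)
open import Algebra.Properties.CommutativeSemigroup +-commutativeSemigroup
  using () renaming (interchange to +-interchange)
open import Algebra.Properties.CommutativeSemigroup *-commutativeSemigroup
  using () renaming (interchange to *-interchange; x∙yz≈y∙xz to *-left-comm)
open import Data.Product using (∃-syntax; _×_; _,_; proj₂)
open import Data.Sum using (inj₁; inj₂)
open import Relation.Nullary using (Dec; yes; no; contradiction; _×-dec_)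
open import Relation.Nullary.Decidable using (from-yes)
open import Relation.Binary.PropositionalEquality
  using (_≡_; _≢_; refl; sym; trans; cong; cong₂; subst; module ≡-Reasoning)

∑-syntax : {A : Set} → List A → (A → ℕ) → ℕ
∑-syntax xs f = sum (map f xs)

infixl 10 ∑-syntax
syntax ∑-syntax xs (λ x → e) = ∑[ x ∈ xs ] e

module _ {A : Set} where

  ∑-cong : (xs : List A) {f g : A → ℕ} → (∀ x → f x ≡ g x) →
           ∑[ x ∈ xs ] f x ≡ ∑[ x ∈ xs ] g x
  ∑-cong []       f≡g = refl
  ∑-cong (x ∷ xs) f≡g = cong₂ _+_ (f≡g x) (∑-cong xs f≡g)

  ∑-zero : (xs : List A) → ∑[ x ∈ xs ] 0 ≡ 0
  ∑-zero []       = refl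
  ∑-zero (x ∷ xs) = ∑-zero xs

  ∑-distrib-+ : (xs : List A) (f g : A → ℕ) →
                ∑[ x ∈ xs ] (f x + g x) ≡ ∑[ x ∈ xs ] f x + ∑[ x ∈ xs ] g x
  ∑-distrib-+ []       f g = refl
  ∑-distrib-+ (x ∷ xs) f g =
    trans (cong (f x + g x +_) (∑-distrib-+ xs f g)) (+-interchange (f x) (g x) _ _)

  *-distribˡ-∑ : (c : ℕ) (xs : List A) (f : A → ℕ) →
                 c * ∑[ x ∈ xs ] f x ≡ ∑[ x ∈ xs ] (c * f x)
  *-distribˡ-∑ c []       f = *-zeroʳ c
  *-distribˡ-∑ c (x ∷ xs) f =
    trans (*-distribˡ-+ c (f x) _) (cong (c * f x +_) (*-distribˡ-∑ c xs f))

  *-distribʳ-∑ : (c : ℕ) (xs : List A) (f : A → ℕ) →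
                 ∑[ x ∈ xs ] f x * c ≡ ∑[ x ∈ xs ] (f x * c)
  *-distribʳ-∑ c []       f = refl
  *-distribʳ-∑ c (x ∷ xs) f =
    trans (*-distribʳ-+ c (f x) _) (cong (f x * c +_) (*-distribʳ-∑ c xs f))

∑-comm : {A B : Set} (xs : List A) (ys : List B) (h : A → B → ℕ) →
         ∑[ x ∈ xs ] ∑[ y ∈ ys ] h x y ≡ ∑[ y ∈ ys ] ∑[ x ∈ xs ] h x y
∑-comm []       ys h = sym (∑-zero ys)
∑-comm (x ∷ xs) ys h = trans (cong (∑[ y ∈ ys ] h x y +_) (∑-comm xs ys h))
                             (sym (∑-distrib-+ ys (h x) (λ y → ∑[ x ∈ xs ] h x y)))

∑∑∑-factor : {A B C : Set} (xs : List A) (ys : List B) (zs : List C)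
             (f : C → A → ℕ) (g : C → B → ℕ) →
             ∑[ x ∈ xs ] ∑[ y ∈ ys ] ∑[ z ∈ zs ] (f z x * g z y)
             ≡ ∑[ z ∈ zs ] (∑[ x ∈ xs ] f z x * ∑[ y ∈ ys ] g z y)
∑∑∑-factor xs ys zs f g = begin
  ∑[ x ∈ xs ] ∑[ y ∈ ys ] ∑[ z ∈ zs ] (f z x * g z y)
    ≡⟨ ∑-cong xs (λ x → ∑-comm ys zs (λ y z → f z x * g z y)) ⟩
  ∑[ x ∈ xs ] ∑[ z ∈ zs ] ∑[ y ∈ ys ] (f z x * g z y)
    ≡⟨ ∑-cong xs (λ x → ∑-cong zs (λ z → sym (*-distribˡ-∑ (f z x) ys (g z)))) ⟩
  ∑[ x ∈ xs ] ∑[ z ∈ zs ] (f z x * ∑[ y ∈ ys ] g z y)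
    ≡⟨ ∑-comm xs zs (λ x z → f z x * ∑[ y ∈ ys ] g z y) ⟩
  ∑[ z ∈ zs ] ∑[ x ∈ xs ] (f z x * ∑[ y ∈ ys ] g z y)
    ≡⟨ ∑-cong zs (λ z → sym (*-distribʳ-∑ (∑[ y ∈ ys ] g z y) xs (f z))) ⟩
  ∑[ z ∈ zs ] (∑[ x ∈ xs ] f z x * ∑[ y ∈ ys ] g z y) ∎
  where open ≡-Reasoning

sum-concatMap-map : {A B : Set} (xs : List A) (ys : List B) (h : A → B → ℕ) →
                    sum (concatMap (λ x → map (h x) ys) xs) ≡ ∑[ x ∈ xs ] ∑[ y ∈ ys ] h x y
sum-concatMap-map []       ys h = refl
sum-concatMap-map (x ∷ xs) ys h =
  trans (sum-++ (map (h x) ys) _) (cong (∑[ y ∈ ys ] h x y +_) (sum-concatMap-map xs ys h))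

^-distribʳ-* : ∀ m n o → (m * n) ^ o ≡ m ^ o * n ^ o
^-distribʳ-* m n zero    = refl
^-distribʳ-* m n (suc o) =
  trans (cong (m * n *_) (^-distribʳ-* m n o)) (*-interchange m n (m ^ o) (n ^ o))

^-distribʳ-*₃ : ∀ x y z m → (x * y * z) ^ m ≡ x ^ m * y ^ m * z ^ m
^-distribʳ-*₃ x y z m = trans (^-distribʳ-* (x * y) z m) (cong (_* z ^ m) (^-distribʳ-* x y m))

bernoulli : ∀ e j → e ^ j * (e + j) ≤ suc e ^ j * e
bernoulli e zero    = ≤-reflexive (cong (1 *_) (+-identityʳ e))
bernoulli e (suc j) = begin
  e * e ^ j * (e + suc j)              ≤⟨ m≤m+n _ (e ^ j * j) ⟩
  e * e ^ j * (e + suc j) + e ^ j * j  ≡⟨ regroup e (e ^ j) j ⟩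
  suc e * (e ^ j * (e + j))            ≤⟨ *-monoʳ-≤ (suc e) (bernoulli e j) ⟩
  suc e * (suc e ^ j * e)              ≡⟨ sym (*-assoc (suc e) (suc e ^ j) e) ⟩
  suc e * suc e ^ j * e                ∎
  where
  open ≤-Reasoning
  regroup : ∀ e x j → e * x * (e + suc j) + x * j ≡ suc e * (x * (e + j))
  regroup = solve-∀

c*e^j≤d^j : ∀ c e d j .{{_ : NonZero e}} → e < d → c * e ≤ j → c * e ^ j ≤ d ^ j
c*e^j≤d^j c e d j e<d ce≤j = *-cancelʳ-≤ (c * e ^ j) (d ^ j) e (begin
  c * e ^ j * e    ≡⟨ regroup c (e ^ j) e ⟩
  e ^ j * (c * e)  ≤⟨ *-monoʳ-≤ (e ^ j) (≤-trans ce≤j (m≤n+m j e)) ⟩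
  e ^ j * (e + j)  ≤⟨ bernoulli e j ⟩
  suc e ^ j * e    ≤⟨ *-monoˡ-≤ e (^-monoˡ-≤ j e<d) ⟩
  d ^ j * e        ∎)
  where
  open ≤-Reasoning
  regroup : ∀ c x e → c * x * e ≡ x * (c * e)
  regroup = solve-∀

^-blocks : ∀ x y p q j r → x ^ (p * j + r) * y ^ (q * j + r) ≡ (x ^ p * y ^ q) ^ j * (x * y) ^ r
^-blocks x y p q j r = begin
  x ^ (p * j + r) * y ^ (q * j + r)
    ≡⟨ cong₂ _*_ (^-distribˡ-+-* x (p * j) r) (^-distribˡ-+-* y (q * j) r) ⟩
  x ^ (p * j) * x ^ r * (y ^ (q * j) * y ^ r)
    ≡⟨ *-interchange (x ^ (p * j)) (x ^ r) (y ^ (q * j)) (y ^ r) ⟩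
  x ^ (p * j) * y ^ (q * j) * (x ^ r * y ^ r)
    ≡⟨ cong₂ _*_ (cong₂ _*_ (sym (^-*-assoc x p j)) (sym (^-*-assoc y q j)))
                 (sym (^-distribʳ-* x y r)) ⟩
  (x ^ p) ^ j * (y ^ q) ^ j * (x * y) ^ r
    ≡⟨ cong (_* (x * y) ^ r) (sym (^-distribʳ-* (x ^ p) (y ^ q) j)) ⟩
  (x ^ p * y ^ q) ^ j * (x * y) ^ r ∎
  where open ≡-Reasoning

∑-strings-suc : ∀ n (f : List Bool → ℕ) →
                ∑[ s ∈ strings (suc n) ] f s ≡ ∑[ w ∈ strings n ] (f (false ∷ w) + f (true ∷ w))
∑-strings-suc n f = go (strings n)
  where
  go : ∀ ws → ∑[ s ∈ concatMap (λ w → (false ∷ w) ∷ (true ∷ w) ∷ []) ws ] f s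
              ≡ ∑[ w ∈ ws ] (f (false ∷ w) + f (true ∷ w))
  go []       = refl
  go (w ∷ ws) = trans (cong (λ r → f (false ∷ w) + (f (true ∷ w) + r)) (go ws))
                      (sym (+-assoc (f (false ∷ w)) _ _))

∑-strings-mono-≤ : ∀ n {f g : List Bool → ℕ} → (∀ s → length s ≡ n → f s ≤ g s) →
                   ∑[ s ∈ strings n ] f s ≤ ∑[ s ∈ strings n ] g s
∑-strings-mono-≤ zero    f≤g = +-monoˡ-≤ 0 (f≤g [] refl)
∑-strings-mono-≤ (suc n) {f} {g} f≤g rewrite ∑-strings-suc n f | ∑-strings-suc n g =
  ∑-strings-mono-≤ n λ w ∣w∣≡n →
    +-mono-≤ (f≤g (false ∷ w) (cong suc ∣w∣≡n)) (f≤g (true ∷ w) (cong suc ∣w∣≡n))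

∑-strings-const : ∀ n c → ∑[ _ ∈ strings n ] c ≡ 2 ^ n * c
∑-strings-const zero    c = refl
∑-strings-const (suc n) c = begin
  ∑[ _ ∈ strings (suc n) ] c  ≡⟨ ∑-strings-suc n (λ _ → c) ⟩
  ∑[ _ ∈ strings n ] (c + c)  ≡⟨ ∑-strings-const n (c + c) ⟩
  2 ^ n * (c + c)             ≡⟨ regroup (2 ^ n) c ⟩
  2 * 2 ^ n * c               ∎
  where
  open ≡-Reasoning
  regroup : ∀ x c → x * (c + c) ≡ 2 * x * c
  regroup = solve-∀

term≤∑-strings : ∀ (w : List Bool) (f : List Bool → ℕ) →
                 f w ≤ ∑[ s ∈ strings (length w) ] f s
term≤∑-strings []      f = m≤m+n (f []) 0
term≤∑-strings (x ∷ w) f rewrite ∑-strings-suc (length w) f =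
  ≤-trans (≤-either x) (term≤∑-strings w (λ v → f (false ∷ v) + f (true ∷ v)))
  where
  ≤-either : ∀ x → f (x ∷ w) ≤ f (false ∷ w) + f (true ∷ w)
  ≤-either false = m≤m+n _ _
  ≤-either true  = m≤n+m _ _

∑-strings-affine : ∀ n c d (f : List Bool → ℕ) →
                   ∑[ s ∈ strings n ] (c + d * f s) ≡ 2 ^ n * c + d * ∑[ s ∈ strings n ] f s
∑-strings-affine n c d f = trans (∑-distrib-+ (strings n) (λ _ → c) (λ s → d * f s))
  (cong₂ _+_ (∑-strings-const n c) (sym (*-distribˡ-∑ d (strings n) f)))

𝟙 : {P : Set} → Dec P → ℕ
𝟙 (yes _) = 1
𝟙 (no _)  = 0

𝟙-mono : {P Q : Set} (p? : Dec P) (q? : Dec Q) → (P → Q) → 𝟙 p? ≤ 𝟙 q?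
𝟙-mono (yes p) (yes q) P⇒Q = ≤-refl
𝟙-mono (yes p) (no ¬q) P⇒Q = contradiction (P⇒Q p) ¬q
𝟙-mono (no ¬p) q?      P⇒Q = z≤n

𝟙-yes : {P : Set} (p? : Dec P) → P → 𝟙 p? ≡ 1
𝟙-yes (yes _) p = refl
𝟙-yes (no ¬p) p = contradiction p ¬p

𝟙-⊆-∷⁻ : ∀ x y u w → 𝟙 ((x ∷ u) ⊆? (y ∷ w)) ≤ 𝟙 (u ⊆? w)
𝟙-⊆-∷⁻ x y u w = 𝟙-mono ((x ∷ u) ⊆? (y ∷ w)) (u ⊆? w) ∷⁻

𝟙-⊆-∷ʳ⁻ : ∀ x y u w → x ≢ y → 𝟙 ((x ∷ u) ⊆? (y ∷ w)) ≤ 𝟙 ((x ∷ u) ⊆? w)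
𝟙-⊆-∷ʳ⁻ x y u w x≢y = 𝟙-mono ((x ∷ u) ⊆? (y ∷ w)) ((x ∷ u) ⊆? w) (∷ʳ⁻ x≢y)

𝟙-⊆-∷-≤ : ∀ x u w → 𝟙 ((x ∷ u) ⊆? (false ∷ w)) + 𝟙 ((x ∷ u) ⊆? (true ∷ w))
                    ≤ 𝟙 (u ⊆? w) + 𝟙 ((x ∷ u) ⊆? w)
𝟙-⊆-∷-≤ false u w = +-mono-≤ (𝟙-⊆-∷⁻ false false u w) (𝟙-⊆-∷ʳ⁻ false true u w λ ())
𝟙-⊆-∷-≤ true  u w = ≤-trans (≤-reflexive (+-comm (𝟙 ((true ∷ u) ⊆? (false ∷ w))) _))
  (+-mono-≤ (𝟙-⊆-∷⁻ true true u w) (𝟙-⊆-∷ʳ⁻ true false u w λ ()))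

superseqCount : ℕ → List Bool → ℕ
superseqCount n u = ∑[ s ∈ strings n ] 𝟙 (u ⊆? s)

superseqCount-[] : ∀ n → superseqCount n [] ≡ 2 ^ n
superseqCount-[] n = begin
  ∑[ s ∈ strings n ] 𝟙 ([] ⊆? s)  ≡⟨ ∑-cong (strings n) (λ s → 𝟙-yes ([] ⊆? s) (minimum s)) ⟩
  ∑[ s ∈ strings n ] 1            ≡⟨ ∑-strings-const n 1 ⟩
  2 ^ n * 1                       ≡⟨ *-identityʳ (2 ^ n) ⟩
  2 ^ n                           ∎
  where open ≡-Reasoning

superseqCount-∷ : ∀ n x u →
  superseqCount (suc n) (x ∷ u) ≤ superseqCount n u + superseqCount n (x ∷ u)
superseqCount-∷ n x u = begin
  superseqCount (suc n) (x ∷ u)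
    ≡⟨ ∑-strings-suc n (λ s → 𝟙 ((x ∷ u) ⊆? s)) ⟩
  ∑[ w ∈ strings n ] (𝟙 ((x ∷ u) ⊆? (false ∷ w)) + 𝟙 ((x ∷ u) ⊆? (true ∷ w)))
    ≤⟨ ∑-strings-mono-≤ n (λ w _ → 𝟙-⊆-∷-≤ x u w) ⟩
  ∑[ w ∈ strings n ] (𝟙 (u ⊆? w) + 𝟙 ((x ∷ u) ⊆? w))
    ≡⟨ ∑-distrib-+ (strings n) _ _ ⟩
  superseqCount n u + superseqCount n (x ∷ u) ∎
  where open ≤-Reasoning

commonSubseqTriples : ℕ → ℕ → ℕ
commonSubseqTriples n L = ∑[ u ∈ strings L ] (superseqCount n u * superseqCount n u)

module _ {a b : ℕ} (a≤b : a ≤ b) where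

  superseqCount-weighted : ∀ n u →
    a ^ n * b ^ length u * superseqCount n u ≤ a ^ length u * (a + b) ^ n
  superseqCount-weighted n [] = begin
    a ^ n * 1 * superseqCount n []  ≡⟨ cong₂ _*_ (*-identityʳ (a ^ n)) (superseqCount-[] n) ⟩
    a ^ n * 2 ^ n                  ≡⟨ sym (^-distribʳ-* a 2 n) ⟩
    (a * 2) ^ n                    ≤⟨ ^-monoˡ-≤ n a*2≤a+b ⟩
    (a + b) ^ n                    ≡⟨ sym (*-identityˡ _) ⟩
    1 * (a + b) ^ n                ∎
    where
    open ≤-Reasoning
    a*2≤a+b : a * 2 ≤ a + b
    a*2≤a+b = ≤-trans (≤-reflexive (trans (*-comm a 2) (cong (a +_) (+-identityʳ a))))
                      (+-monoʳ-≤ a a≤b)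
  superseqCount-weighted zero    (x ∷ u) =
    ≤-trans (≤-reflexive (*-zeroʳ (1 * b ^ length (x ∷ u)))) z≤n
  superseqCount-weighted (suc n) (x ∷ u) = begin
    a * a ^ n * (b * b ^ L) * G (suc n) (x ∷ u)
      ≤⟨ *-monoʳ-≤ (a * a ^ n * (b * b ^ L)) (superseqCount-∷ n x u) ⟩
    a * a ^ n * (b * b ^ L) * (G n u + G n (x ∷ u))
      ≡⟨ expand a b (a ^ n) (b ^ L) (G n u) (G n (x ∷ u)) ⟩
    a * b * (a ^ n * b ^ L * G n u) + a * (a ^ n * (b * b ^ L) * G n (x ∷ u))
      ≤⟨ +-mono-≤ (*-monoʳ-≤ (a * b) (superseqCount-weighted n u))
                  (*-monoʳ-≤ a (superseqCount-weighted n (x ∷ u))) ⟩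
    a * b * (a ^ L * (a + b) ^ n) + a * (a * a ^ L * (a + b) ^ n)
      ≡⟨ collect a b (a ^ L) ((a + b) ^ n) ⟩
    a * a ^ L * ((a + b) * (a + b) ^ n) ∎
    where
    open ≤-Reasoning
    G : ℕ → List Bool → ℕ
    G = superseqCount
    L : ℕ
    L = length u
    expand : ∀ a b x y g h → a * x * (b * y) * (g + h) ≡ a * b * (x * y * g) + a * (x * (b * y) * h)
    expand = solve-∀
    collect : ∀ a b x y → a * b * (x * y) + a * (a * x * y) ≡ a * x * ((a + b) * y)
    collect = solve-∀

  commonSubseqTriples-weighted : ∀ n L →
    let K = a ^ n * b ^ L; M = a ^ L * (a + b) ^ n in
    K * K * commonSubseqTriples n L ≤ 2 ^ L * (M * M)
  commonSubseqTriples-weighted n L = begin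
    K * K * ∑[ u ∈ strings L ] (G u * G u)  ≡⟨ *-distribˡ-∑ (K * K) (strings L) (λ u → G u * G u) ⟩
    ∑[ u ∈ strings L ] (K * K * (G u * G u)) ≤⟨ ∑-strings-mono-≤ L squared-bound ⟩
    ∑[ _ ∈ strings L ] (M * M)               ≡⟨ ∑-strings-const L (M * M) ⟩
    2 ^ L * (M * M)                          ∎
    where
    open ≤-Reasoning
    K M : ℕ
    K = a ^ n * b ^ L
    M = a ^ L * (a + b) ^ n
    G : List Bool → ℕ
    G = superseqCount n
    bound : ∀ u → length u ≡ L → K * G u ≤ M
    bound u refl = superseqCount-weighted n u
    squared-bound : ∀ u → length u ≡ L → K * K * (G u * G u) ≤ M * M
    squared-bound u ∣u∣≡L = ≤-trans (≤-reflexive (*-interchange K K (G u) (G u)))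
                                    (*-mono-≤ (bound u ∣u∣≡L) (bound u ∣u∣≡L))

  commonSubseqTriples≤4ⁿ : .{{_ : NonZero a}} .{{_ : NonZero b}} → ∀ c n L →
    c * ((2 * a * a) ^ L * ((a + b) * (a + b)) ^ n) ≤ (b * b) ^ L * (a * a * 4) ^ n →
    c * commonSubseqTriples n L ≤ 4 ^ n
  commonSubseqTriples≤4ⁿ c n L per-letter = *-cancelˡ-≤ (K * K) {{K*K≢0}} (begin
    K * K * (c * T)                                  ≡⟨ *-left-comm (K * K) c T ⟩
    c * (K * K * T)                                  ≤⟨ *-monoʳ-≤ c (commonSubseqTriples-weighted n L) ⟩
    c * (2 ^ L * (M * M))                            ≡⟨ cong (c *_) regroupₗ ⟩
    c * ((2 * a * a) ^ L * ((a + b) * (a + b)) ^ n)  ≤⟨ per-letter ⟩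
    (b * b) ^ L * (a * a * 4) ^ n                    ≡⟨ regroupᵣ ⟩
    K * K * 4 ^ n                                    ∎)
    where
    open ≤-Reasoning
    K M T : ℕ
    K = a ^ n * b ^ L
    M = a ^ L * (a + b) ^ n
    T = commonSubseqTriples n L
    K≢0 : NonZero K
    K≢0 = m*n≢0 (a ^ n) (b ^ L) {{m^n≢0 a n}} {{m^n≢0 b L}}
    K*K≢0 : NonZero (K * K)
    K*K≢0 = m*n≢0 K K {{K≢0}} {{K≢0}}
    shuffleₗ : ∀ z x y → z * (x * y * (x * y)) ≡ z * x * x * (y * y)
    shuffleₗ = solve-∀
    shuffleᵣ : ∀ x y z → y * y * (x * x * z) ≡ x * y * (x * y) * z
    shuffleᵣ = solve-∀
    regroupₗ : 2 ^ L * (M * M) ≡ (2 * a * a) ^ L * ((a + b) * (a + b)) ^ n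
    regroupₗ = trans (shuffleₗ (2 ^ L) (a ^ L) ((a + b) ^ n))
      (sym (cong₂ _*_ (^-distribʳ-*₃ 2 a a L) (^-distribʳ-* (a + b) (a + b) n)))
    regroupᵣ : (b * b) ^ L * (a * a * 4) ^ n ≡ K * K * 4 ^ n
    regroupᵣ = trans (cong₂ _*_ (^-distribʳ-* b b L) (^-distribʳ-*₃ a a 4 n))
      (shuffleᵣ (a ^ n) (b ^ L) (4 ^ n))

module _ (s t : List Bool) where
  private
    common? : (u : List Bool) → Dec (IsCommonSubseq u s t)
    common? u = (u ⊆? s) ×-dec (u ⊆? t)
    candidates : List (List Bool)
    candidates = concatMap strings (upTo (suc (length s)))

  LCS-attained : ∃[ w ] IsCommonSubseq w s t × LCS s t ≡ length w
  LCS-attained with foldr-selective ⊔-sel 0 (map length (filter common? candidates))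
  ... | inj₁ LCS≡0         = [] , (minimum s , minimum t) , LCS≡0
  ... | inj₂ LCS∈lengths with ∈-map⁻ length LCS∈lengths
  ...   | w , w∈ , LCS≡∣w∣ = w , proj₂ (∈-filter⁻ common? {xs = candidates} w∈) , LCS≡∣w∣

LCS≤length : ∀ s t → LCS s t ≤ length s
LCS≤length s t with LCS-attained s t
... | w , (w⊆s , _) , LCS≡∣w∣ = ≤-trans (≤-reflexive LCS≡∣w∣) (length-mono-≤ w⊆s)

common-subseq-of-length : ∀ L s t → L < LCS s t → ∃[ w ] length w ≡ L × IsCommonSubseq w s t
common-subseq-of-length L s t L<LCS with LCS-attained s t
... | w , (w⊆s , w⊆t) , LCS≡∣w∣ =
  take L w , ∣take-L-w∣≡L , (take-Sublist L w⊆s , take-Sublist L w⊆t)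
  where
  ∣take-L-w∣≡L : length (take L w) ≡ L
  ∣take-L-w∣≡L = trans (length-take L w) (m≤n⇒m⊓n≡m (<⇒≤ (subst (L <_) LCS≡∣w∣ L<LCS)))

commonSubseqs : ℕ → List Bool → List Bool → ℕ
commonSubseqs L s t = ∑[ u ∈ strings L ] (𝟙 (u ⊆? s) * 𝟙 (u ⊆? t))

commonSubseqs-pos : ∀ L s t → L < LCS s t → 1 ≤ commonSubseqs L s t
commonSubseqs-pos L s t L<LCS with common-subseq-of-length L s t L<LCS
... | w , refl , (w⊆s , w⊆t) = begin
  1                            ≡⟨ sym (cong₂ _*_ (𝟙-yes (w ⊆? s) w⊆s) (𝟙-yes (w ⊆? t) w⊆t)) ⟩
  𝟙 (w ⊆? s) * 𝟙 (w ⊆? t)     ≤⟨ term≤∑-strings w (λ u → 𝟙 (u ⊆? s) * 𝟙 (u ⊆? t)) ⟩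
  commonSubseqs (length w) s t ∎
  where open ≤-Reasoning

LCS≤+commonSubseqs : ∀ L s t → LCS s t ≤ L + length s * commonSubseqs L s t
LCS≤+commonSubseqs L s t with LCS s t ≤? L
... | yes LCS≤L = ≤-trans LCS≤L (m≤m+n L _)
... | no  LCS≰L = begin
  LCS s t                          ≤⟨ LCS≤length s t ⟩
  length s                         ≤⟨ m≤m*n (length s) (commonSubseqs L s t) {{cs≢0}} ⟩
  length s * commonSubseqs L s t   ≤⟨ m≤n+m _ L ⟩
  L + length s * commonSubseqs L s t ∎
  where
  open ≤-Reasoning
  cs≢0 : NonZero (commonSubseqs L s t)
  cs≢0 = >-nonZero (commonSubseqs-pos L s t (≰⇒> LCS≰L))

∑∑-commonSubseqs : ∀ n L →
  ∑[ s ∈ strings n ] ∑[ t ∈ strings n ] commonSubseqs L s t ≡ commonSubseqTriples n L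
∑∑-commonSubseqs n L =
  ∑∑∑-factor (strings n) (strings n) (strings L) (λ u s → 𝟙 (u ⊆? s)) (λ u t → 𝟙 (u ⊆? t))

totalLCS≤ : ∀ n L → totalLCS n ≤ 4 ^ n * L + n * commonSubseqTriples n L
totalLCS≤ n L = begin
  totalLCS n
    ≡⟨ sum-concatMap-map (strings n) (strings n) LCS ⟩
  ∑[ s ∈ strings n ] ∑[ t ∈ strings n ] LCS s t
    ≤⟨ ∑-strings-mono-≤ n (λ s ∣s∣≡n → ∑-strings-mono-≤ n (λ t _ → first-moment s t ∣s∣≡n)) ⟩
  ∑[ s ∈ strings n ] ∑[ t ∈ strings n ] (L + n * cs s t)
    ≡⟨ ∑-cong (strings n) (λ s → ∑-strings-affine n L n (cs s)) ⟩
  ∑[ s ∈ strings n ] (2 ^ n * L + n * ∑[ t ∈ strings n ] cs s t)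
    ≡⟨ ∑-strings-affine n (2 ^ n * L) n (λ s → ∑[ t ∈ strings n ] cs s t) ⟩
  2 ^ n * (2 ^ n * L) + n * ∑[ s ∈ strings n ] ∑[ t ∈ strings n ] cs s t
    ≡⟨ cong₂ _+_ 2ⁿ2ⁿ≡4ⁿ (cong (n *_) (∑∑-commonSubseqs n L)) ⟩
  4 ^ n * L + n * commonSubseqTriples n L ∎
  where
  open ≤-Reasoning
  cs : List Bool → List Bool → ℕ
  cs = commonSubseqs L
  first-moment : ∀ s t → length s ≡ n → LCS s t ≤ L + n * cs s t
  first-moment s t refl = LCS≤+commonSubseqs L s t
  2ⁿ2ⁿ≡4ⁿ : 2 ^ n * (2 ^ n * L) ≡ 4 ^ n * L
  2ⁿ2ⁿ≡4ⁿ = trans (sym (*-assoc (2 ^ n) (2 ^ n) L)) (cong (_* L) (sym (^-distribʳ-* 2 2 n)))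

expectedLCS≤ : ∀ p q c n L → q * L ≤ p * n → c * commonSubseqTriples n L ≤ 4 ^ n →
               c * q * totalLCS n ≤ (p * c + q) * n * 4 ^ n
expectedLCS≤ p q c n L qL≤pn cT≤4ⁿ = begin
  c * q * totalLCS n
    ≤⟨ *-monoʳ-≤ (c * q) (totalLCS≤ n L) ⟩
  c * q * (4 ^ n * L + n * T)
    ≡⟨ expand c q (4 ^ n) L n T ⟩
  q * L * (c * 4 ^ n) + q * n * (c * T)
    ≤⟨ +-mono-≤ (*-monoˡ-≤ (c * 4 ^ n) qL≤pn) (*-monoʳ-≤ (q * n) cT≤4ⁿ) ⟩
  p * n * (c * 4 ^ n) + q * n * 4 ^ n
    ≡⟨ collect p q c n (4 ^ n) ⟩
  (p * c + q) * n * 4 ^ n ∎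
  where
  open ≤-Reasoning
  T : ℕ
  T = commonSubseqTriples n L
  expand : ∀ c q f L n T → c * q * (f * L + n * T) ≡ q * L * (c * f) + q * n * (c * T)
  expand = solve-∀
  collect : ∀ p q c n f → p * n * (c * f) + q * n * f ≡ (p * c + q) * n * f
  collect = solve-∀

-- The per-letter factors of commonSubseqTriples≤4ⁿ at a = 2, b = 13 are 2a² = 8,
-- (a+b)² = 225, b² = 169 and 4a² = 16; a block has 13 letters of u and 15 of s.
E D : ℕ
E = 8 ^ 13 * 225 ^ 15
D = 169 ^ 13 * 16 ^ 15

c*8^L*225^n≤169^L*16^n : ∀ c j r → c * E ≤ j →
  c * (8 ^ (13 * j + r) * 225 ^ (15 * j + r)) ≤ 169 ^ (13 * j + r) * 16 ^ (15 * j + r)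
c*8^L*225^n≤169^L*16^n c j r cE≤j = begin
  c * (8 ^ (13 * j + r) * 225 ^ (15 * j + r))  ≡⟨ cong (c *_) (^-blocks 8 225 13 15 j r) ⟩
  c * (E ^ j * 1800 ^ r)                       ≡⟨ sym (*-assoc c (E ^ j) (1800 ^ r)) ⟩
  c * E ^ j * 1800 ^ r                         ≤⟨ *-mono-≤ (c*e^j≤d^j c E D j E<D cE≤j)
                                                           (^-monoˡ-≤ r (from-yes (1800 ≤? 2704))) ⟩
  D ^ j * 2704 ^ r                             ≡⟨ sym (^-blocks 169 16 13 15 j r) ⟩
  169 ^ (13 * j + r) * 16 ^ (15 * j + r)       ∎
  where
  open ≤-Reasoning
  E<D : E < D
  E<D = from-yes (E <? D)

[13j+r]/[15j+r]≤867/1000 : ∀ j r → r < 15 → 399 ≤ j → 1000 * (13 * j + r) ≤ 867 * (15 * j + r)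
[13j+r]/[15j+r]≤867/1000 j r r<15 399≤j = begin
  1000 * (13 * j + r)              ≡⟨ expand j r ⟩
  13000 * j + 133 * r + 867 * r    ≤⟨ +-monoˡ-≤ (867 * r) (+-monoʳ-≤ (13000 * j) 133r≤5j) ⟩
  13000 * j + 5 * j + 867 * r      ≡⟨ collect j r ⟩
  867 * (15 * j + r)               ∎
  where
  open ≤-Reasoning
  133r≤5j : 133 * r ≤ 5 * j
  133r≤5j = ≤-trans (*-monoʳ-≤ 133 (<⇒≤ r<15)) (*-monoʳ-≤ 5 399≤j)
  expand : ∀ j r → 1000 * (13 * j + r) ≡ 13000 * j + 133 * r + 867 * r
  expand = solve-∀
  collect : ∀ j r → 13000 * j + 5 * j + 867 * r ≡ 867 * (15 * j + r)
  collect = solve-∀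

divide-by-15 : ∀ J n → J * 15 ≤ n → ∃[ j ] ∃[ r ] J ≤ j × r < 15 × n ≡ 15 * j + r
divide-by-15 J n J*15≤n = n / 15 , n % 15 , J≤n/15 , m%n<n n 15 , n≡15*[n/15]+[n%15]
  where
  J≤n/15 : J ≤ n / 15
  J≤n/15 = subst (_≤ n / 15) (m*n/n≡m J 15) (/-monoˡ-≤ 15 J*15≤n)
  n≡15*[n/15]+[n%15] : n ≡ 15 * (n / 15) + n % 15
  n≡15*[n/15]+[n%15] = trans (m≡m%n+[m/n]*n n 15)
    (trans (+-comm (n % 15) _) (cong (_+ n % 15) (*-comm (n / 15) 15)))

totalLCS≤-beyond : ∀ c J .{{_ : NonZero c}} → c * E ≤ J → ∀ n → J * 15 ≤ n →
                   c * 1000 * totalLCS n ≤ (867 * c + 1000) * n * 4 ^ n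
totalLCS≤-beyond c J cE≤J n J*15≤n with divide-by-15 J n J*15≤n
... | j , r , J≤j , r<15 , refl = expectedLCS≤ 867 1000 c (15 * j + r) (13 * j + r)
  ([13j+r]/[15j+r]≤867/1000 j r r<15 (≤-trans 399≤J J≤j))
  (commonSubseqTriples≤4ⁿ (from-yes (2 ≤? 13)) c (15 * j + r) (13 * j + r)
    (c*8^L*225^n≤169^L*16^n c j r (≤-trans cE≤J J≤j)))
  where
  399≤J : 399 ≤ J
  399≤J = ≤-trans (from-yes (399 ≤? E)) (≤-trans (m≤n*m E c) cE≤J)

theorem5p1 : (k : ℕ) → ∃[ N ] ((n : ℕ) → N ≤ n →
               suc k * 1000 * totalLCS n ≤ (867 * suc k + 1000) * n * 4 ^ n)
theorem5p1 k = suc k * E * 15 , totalLCS≤-beyond (suc k) (suc k * E) ≤-refl
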